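{- Let $a,b\in\mathbb Z$ and let $m$ be a positive integer with $m\in\mathcal F=\{5^k, 2\cdot 5^k, 4\cdot 5^k, 3^j5^k, 6\cdot 5^k, 7\cdot 5^k, 14\cdot 5^k : k\ge 0, j\ge 1\}$, $\gcd(5,m)=1$, and $\gcd(5m, b^2-ab-a^2)=1$. Let $w_0=a$, $w_1=b$, $w_n=w_{n-1}+w_{n-2}$. If the sequence $(w_n)$ modulo $m$ is residue complete, then the sequence $(w_n)$ modulo $5m$ is residue complete.
   Context: For fixed integers $a,b$, $w_n=w_n(a,b)$ is defined by $w_0=a$, $w_1=b$, $w_n=w_{n-1}+w_{n-2}$; modulo $m$ it is periodic, and a period is denoted $w(a,b,m)$ (a Fibonacci cycle modulo $m$). It is residue complete if every $x\in\mathbb Z_m$ occurs in it. -}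

module Defs where

open import Data.Nat as ℕ using (ℕ; zero; suc; _<_; _≥_)
open import Data.Integer as ℤ using (ℤ; +_; _+_; _-_)
open import Data.Integer.Divisibility using (_∣_)
open import Data.Product using (∃; ∃-syntax; _×_)
open import Data.Sum using (_⊎_)
open import Relation.Binary.PropositionalEquality using (_≡_)

w : ℤ → ℤ → ℕ → ℤ
w a b zero = a
w a b (suc zero) = b
w a b (suc (suc n)) = w a b (suc n) + w a b n

ResidueComplete : ℤ → ℤ → ℕ → Set
ResidueComplete a b m = ∀ (x : ℕ) → x < m → ∃[ n ] ((+ m) ∣ (w a b n - + x))

InF : ℕ → Set
InF m = ∃[ k ]
  ( m ≡ 5 ℕ.^ k
  ⊎ m ≡ 2 ℕ.* 5 ℕ.^ k
  ⊎ m ≡ 4 ℕ.* 5 ℕ.^ k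
  ⊎ (∃[ j ] (j ≥ 1 × m ≡ 3 ℕ.^ j ℕ.* 5 ℕ.^ k))
  ⊎ m ≡ 6 ℕ.* 5 ℕ.^ k
  ⊎ m ≡ 7 ℕ.* 5 ℕ.^ k
  ⊎ m ≡ 14 ℕ.* 5 ℕ.^ k )

module Submission where

-- Write Q(a,b) = b² - ab - a².  Since gcd(5,m) = 1, a modulus m ∈ 𝓕 is one of
-- 1, 2, 4, 3^j, 6, 7, 14, and each of these admits a period N ≡ 4 (mod 20) of
-- every Fibonacci sequence modulo m (checked by computation for the small
-- moduli; for 3^j by lifting a period N mod M to 3N mod 3M when 3 ∣ M).
-- Given a target x mod 5m, residue completeness mod m yields n₀ with
-- w(n₀) ≡ x (mod m), and so does every n₀ + sN.  Modulo 5 the sequence has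
-- period 20, so w(n₀ + sN) ≡ w(n₀ + 4s) (mod 5); and as long as 5 ∤ Q (which
-- is preserved along the sequence up to sign), the five values w(n₀ + 4s),
-- s < 5, run through all residues mod 5 (an exhaustive check on residues).
-- The Chinese remainder theorem combines both congruences.

open import Defs
open import Data.Empty using (⊥-elim)
open import Data.Integer as ℤ
  using (ℤ; +_; -_; _+_; _-_; _*_; ∣_∣; 0ℤ; 1ℤ; _%ℕ_; _/ℕ_)
import Data.Integer.Properties as ℤ
open import Data.Integer.DivMod using (a≡a%ℕn+[a/ℕn]*n; n%ℕd<d)
open import Data.Integer.Divisibility.Signed
  using (_∣_; divides; _∣?_; ∣ᵤ⇒∣; ∣⇒∣ᵤ; ∣-refl; ∣-trans;
         ∣m∣n⇒∣m+n; ∣m⇒∣-m; ∣n⇒∣m*n; ∣m⇒∣m*n)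
open import Data.Integer.Tactic.RingSolver using (solve-∀)
open import Data.Nat as ℕ using (ℕ; zero; suc; _≥_; s≤s; z≤n)
import Data.Nat.Properties as ℕ
open import Data.Nat.Properties using (allUpTo?; anyUpTo?)
import Data.Nat.Tactic.RingSolver as ℕ-Solver
import Data.Nat.Divisibility as ℕDiv
open import Data.Nat.DivMod using (m%n<n)
open import Data.Nat.GCD using (gcd; gcd-greatest)
open import Data.Nat.LCM using (lcm; lcm-least; gcd*lcm)
open import Data.Product using (∃; ∃-syntax; _×_; _,_; proj₁; proj₂)
open import Data.Sum using (_⊎_; inj₁; inj₂)
open import Data.Unit using (tt)
open import Level using (0ℓ)
open import Relation.Binary.Bundles using (Setoid)
open import Relation.Binary.PropositionalEquality
open import Relation.Nullary using (¬_; Dec)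
import Relation.Nullary.Decidable as Dec
open import Relation.Nullary.Decidable using (True; toWitness; from-yes; _×-dec_; _⊎-dec_)

-- x ≡ y mod M : the modulus M divides x - y.  (A record, so that x, y and M
-- are recovered from the type.)
infix 4 _≡_mod_
record _≡_mod_ (x y : ℤ) (M : ℕ) : Set where
  constructor ∣⇒mod
  field mod⇒∣ : + M ∣ (x - y)
open _≡_mod_ public

≡mod-via : ∀ {M x y} z → x - y ≡ z → + M ∣ z → x ≡ y mod M
≡mod-via z eq M∣z = ∣⇒mod (subst (_ ∣_) (sym eq) M∣z)

≡⇒≡mod : ∀ {M x y} → x ≡ y → x ≡ y mod M
≡⇒≡mod {x = x} refl = ≡mod-via 0ℤ (ℤ.+-inverseʳ x) (divides 0ℤ refl)

≡mod-refl : ∀ {M} x → x ≡ x mod M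
≡mod-refl x = ≡⇒≡mod refl

≡mod-sym : ∀ {M x y} → x ≡ y mod M → y ≡ x mod M
≡mod-sym {x = x} {y} (∣⇒mod p) = ≡mod-via (- (x - y)) (negate x y) (∣m⇒∣-m p)
  where
  negate : ∀ x y → y - x ≡ - (x - y)
  negate = solve-∀

≡mod-trans : ∀ {M x y z} → x ≡ y mod M → y ≡ z mod M → x ≡ z mod M
≡mod-trans {x = x} {y} {z} (∣⇒mod p) (∣⇒mod q) =
  ≡mod-via _ (split x y z) (∣m∣n⇒∣m+n p q)
  where
  split : ∀ x y z → x - z ≡ (x - y) + (y - z)
  split = solve-∀

≡mod-+ : ∀ {M x x′ y y′} → x ≡ x′ mod M → y ≡ y′ mod M →
         x + y ≡ x′ + y′ mod M
≡mod-+ {x = x} {x′} {y} {y′} (∣⇒mod p) (∣⇒mod q) =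
  ≡mod-via _ (split x x′ y y′) (∣m∣n⇒∣m+n p q)
  where
  split : ∀ x x′ y y′ → (x + y) - (x′ + y′) ≡ (x - x′) + (y - y′)
  split = solve-∀

≡mod-neg : ∀ {M x y} → x ≡ y mod M → - x ≡ - y mod M
≡mod-neg {x = x} {y} (∣⇒mod p) = ≡mod-via _ (negate x y) (∣m⇒∣-m p)
  where
  negate : ∀ x y → - x - - y ≡ - (x - y)
  negate = solve-∀

≡mod-* : ∀ {M x x′ y y′} → x ≡ x′ mod M → y ≡ y′ mod M →
         x * y ≡ x′ * y′ mod M
≡mod-* {x = x} {x′} {y} {y′} (∣⇒mod p) (∣⇒mod q) =
  ≡mod-via _ (split x x′ y y′) (∣m∣n⇒∣m+n (∣n⇒∣m*n x q) (∣m⇒∣m*n y′ p))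
  where
  split : ∀ x x′ y y′ → x * y - x′ * y′ ≡ x * (y - y′) + (x - x′) * y′
  split = solve-∀

≡mod-divisor : ∀ {p M x y} → p ℕDiv.∣ M → x ≡ y mod M → x ≡ y mod p
≡mod-divisor p∣M (∣⇒mod M∣x-y) = ∣⇒mod (∣-trans (∣ᵤ⇒∣ p∣M) M∣x-y)

≡mod-scale : ∀ {p x y} M → x ≡ y mod p → + M * x ≡ + M * y mod p ℕ.* M
≡mod-scale {p} {x} {y} M (∣⇒mod (divides q eq)) = ∣⇒mod (divides q (begin
  + M * x - + M * y  ≡⟨ factor (+ M) x y ⟩
  + M * (x - y)      ≡⟨ cong (+ M *_) eq ⟩
  + M * (q * + p)    ≡⟨ regroup (+ M) q (+ p) ⟩
  q * (+ p * + M)    ≡⟨ cong (q *_) (ℤ.pos-* p M) ⟨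
  q * + (p ℕ.* M)    ∎))
  where
  open ≡-Reasoning
  factor : ∀ m x y → m * x - m * y ≡ m * (x - y)
  factor = solve-∀
  regroup : ∀ m q p → m * (q * p) ≡ q * (p * m)
  regroup = solve-∀

≡mod-residue : ∀ M .{{_ : ℕ.NonZero M}} x → x ≡ + (x %ℕ M) mod M
≡mod-residue M x = ≡mod-via _ difference (∣n⇒∣m*n (x /ℕ M) ∣-refl)
  where
  cancel : ∀ r q → (r + q) - r ≡ q
  cancel = solve-∀
  difference : x - + (x %ℕ M) ≡ (x /ℕ M) * + M
  difference = trans (cong (_- + (x %ℕ M)) (a≡a%ℕn+[a/ℕn]*n x M)) (cancel (+ (x %ℕ M)) _)

mod-setoid : ℕ → Setoid 0ℓ 0ℓ
mod-setoid M = record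
  { Carrier       = ℤ
  ; _≈_           = _≡_mod M
  ; isEquivalence = record
    { refl = ≡mod-refl _ ; sym = ≡mod-sym ; trans = ≡mod-trans }
  }

module ModReasoning (M : ℕ) where
  open import Relation.Binary.Reasoning.Setoid (mod-setoid M) public

crt : ∀ {m n x y} → gcd m n ≡ 1 → x ≡ y mod m → x ≡ y mod n →
      x ≡ y mod m ℕ.* n
crt {m} {n} coprime (∣⇒mod p) (∣⇒mod q) =
  ∣⇒mod (∣ᵤ⇒∣ (subst (ℕDiv._∣ _) lcm≡mn (lcm-least (∣⇒∣ᵤ p) (∣⇒∣ᵤ q))))
  where
  lcm≡mn : lcm m n ≡ m ℕ.* n
  lcm≡mn = trans (sym (ℕ.*-identityˡ (lcm m n)))
                 (trans (cong (ℕ._* lcm m n) (sym coprime)) (gcd*lcm m n))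

coprime-common-divisor : ∀ {m n d} → gcd m n ≡ 1 →
                         d ℕDiv.∣ m → d ℕDiv.∣ n → d ≡ 1
coprime-common-divisor coprime d∣m d∣n =
  ℕDiv.∣1⇒≡1 (subst (_ ℕDiv.∣_) coprime (gcd-greatest d∣m d∣n))

w-cong : ∀ {M a a′ b b′} → a ≡ a′ mod M → b ≡ b′ mod M →
         ∀ n → w a b n ≡ w a′ b′ n mod M
w-cong p q zero          = p
w-cong p q (suc zero)    = q
w-cong p q (suc (suc n)) = ≡mod-+ (w-cong p q (suc n)) (w-cong p q n)

w-shift : ∀ a b n k → w a b (n ℕ.+ k) ≡ w (w a b k) (w a b (suc k)) n
w-shift a b zero          k = refl
w-shift a b (suc zero)    k = refl
w-shift a b (suc (suc n)) k = cong₂ _+_ (w-shift a b (suc n) k) (w-shift a b n k)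

w-difference : ∀ a b a′ b′ n → w a b n - w a′ b′ n ≡ w (a - a′) (b - b′) n
w-difference a b a′ b′ zero          = refl
w-difference a b a′ b′ (suc zero)    = refl
w-difference a b a′ b′ (suc (suc n)) = begin
  (w a b (suc n) + w a b n) - (w a′ b′ (suc n) + w a′ b′ n)
    ≡⟨ regroup (w a b (suc n)) (w a b n) (w a′ b′ (suc n)) (w a′ b′ n) ⟩
  (w a b (suc n) - w a′ b′ (suc n)) + (w a b n - w a′ b′ n)
    ≡⟨ cong₂ _+_ (w-difference a b a′ b′ (suc n)) (w-difference a b a′ b′ n) ⟩
  w (a - a′) (b - b′) (suc n) + w (a - a′) (b - b′) n ∎
  where
  open ≡-Reasoning
  regroup : ∀ x y x′ y′ → (x + y) - (x′ + y′) ≡ (x - x′) + (y - y′)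
  regroup = solve-∀

w-scale : ∀ a b m n → w (a * m) (b * m) n ≡ w a b n * m
w-scale a b m zero          = refl
w-scale a b m (suc zero)    = refl
w-scale a b m (suc (suc n)) =
  trans (cong₂ _+_ (w-scale a b m (suc n)) (w-scale a b m n))
        (sym (ℤ.*-distribʳ-+ m (w a b (suc n)) (w a b n)))

F G : ℕ → ℤ
F = w 1ℤ 0ℤ
G = w 0ℤ 1ℤ

w-basis : ∀ a b n → w a b n ≡ a * F n + b * G n
w-basis a b zero          = initial₀ a b
  where
  initial₀ : ∀ a b → a ≡ a * 1ℤ + b * 0ℤ
  initial₀ = solve-∀
w-basis a b (suc zero)    = initial₁ a b
  where
  initial₁ : ∀ a b → b ≡ a * 0ℤ + b * 1ℤ
  initial₁ = solve-∀
w-basis a b (suc (suc n)) =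
  trans (cong₂ _+_ (w-basis a b (suc n)) (w-basis a b n))
        (regroup a b (F (suc n)) (G (suc n)) (F n) (G n))
  where
  regroup : ∀ a b f₁ g₁ f₀ g₀ →
            (a * f₁ + b * g₁) + (a * f₀ + b * g₀) ≡ a * (f₁ + f₀) + b * (g₁ + g₀)
  regroup = solve-∀

Period : ℕ → ℕ → Set
Period M N = ∀ a b n → w a b (n ℕ.+ N) ≡ w a b n mod M

BasisFixed : ℕ → ℤ × ℤ → ℤ × ℤ → Set
BasisFixed M (f₀ , f₁) (g₀ , g₁) =
  (f₀ ≡ 1ℤ mod M × f₁ ≡ 0ℤ mod M) × (g₀ ≡ 0ℤ mod M × g₁ ≡ 1ℤ mod M)

-- By linearity, N is a period as soon as the N-step shift fixes the basis.
period-from-basis : ∀ {M N} → BasisFixed M (F N , F (suc N)) (G N , G (suc N)) →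
                    Period M N
period-from-basis {M} {N} ((F₀ , F₁) , (G₀ , G₁)) a b n = begin
  w a b (n ℕ.+ N)                ≡⟨ w-shift a b n N ⟩
  w (w a b N) (w a b (suc N)) n  ≈⟨ w-cong restart₀ restart₁ n ⟩
  w a b n                        ∎
  where
  open ModReasoning M
  basis-value : ∀ k {x y} → F k ≡ x mod M → G k ≡ y mod M →
                w a b k ≡ a * x + b * y mod M
  basis-value k {x} {y} Fk Gk = begin
    w a b k            ≡⟨ w-basis a b k ⟩
    a * F k + b * G k  ≈⟨ ≡mod-+ (≡mod-* (≡mod-refl a) Fk) (≡mod-* (≡mod-refl b) Gk) ⟩
    a * x + b * y      ∎
  first : ∀ a b → a * 1ℤ + b * 0ℤ ≡ a
  first = solve-∀
  second : ∀ a b → a * 0ℤ + b * 1ℤ ≡ b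
  second = solve-∀
  restart₀ : w a b N ≡ a mod M
  restart₀ = ≡mod-trans (basis-value N F₀ G₀) (≡⇒≡mod (first a b))
  restart₁ : w a b (suc N) ≡ b mod M
  restart₁ = ≡mod-trans (basis-value (suc N) F₁ G₁) (≡⇒≡mod (second a b))

-- Fast evaluation of consecutive terms by iterating (x, y) ↦ (y, y + x).
fibPair : ℕ → ℤ → ℤ → ℤ × ℤ
fibPair zero    x y = x , y
fibPair (suc n) x y = fibPair n y (y + x)

fibPair-correct : ∀ a b n → fibPair n a b ≡ (w a b n , w a b (suc n))
fibPair-correct a b n =
  subst (λ i → fibPair n a b ≡ (w a b i , w a b (suc i)))
        (ℕ.+-identityʳ n) (from-index n 0)
  where
  from-index : ∀ n k → fibPair n (w a b k) (w a b (suc k)) ≡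
                       (w a b (n ℕ.+ k) , w a b (suc (n ℕ.+ k)))
  from-index zero    k = refl
  from-index (suc n) k = trans (from-index n (suc k))
    (cong (λ i → w a b i , w a b (suc i)) (ℕ.+-suc n k))

_≡?_mod_ : ∀ x y M → Dec (x ≡ y mod M)
x ≡? y mod M = Dec.map′ ∣⇒mod mod⇒∣ (+ M ∣? (x - y))

basisFixed? : ∀ M p q → Dec (BasisFixed M p q)
basisFixed? M (f₀ , f₁) (g₀ , g₁) =
  ((f₀ ≡? 1ℤ mod M) ×-dec (f₁ ≡? 0ℤ mod M)) ×-dec
  ((g₀ ≡? 0ℤ mod M) ×-dec (g₁ ≡? 1ℤ mod M))

period-by-computation : ∀ M N →
  True (basisFixed? M (fibPair N 1ℤ 0ℤ) (fibPair N 0ℤ 1ℤ)) → Period M N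
period-by-computation M N ok = period-from-basis
  (subst₂ (BasisFixed M) (fibPair-correct 1ℤ 0ℤ N) (fibPair-correct 0ℤ 1ℤ N)
          (toWitness ok))

-- Periods ≡ 4 (mod 20) of the small moduli, and the period 20 modulo 5.
period-1 : Period 1 4
period-1 = period-by-computation 1 4 tt
period-2 : Period 2 24
period-2 = period-by-computation 2 24 tt
period-3 : Period 3 24
period-3 = period-by-computation 3 24 tt
period-4 : Period 4 24
period-4 = period-by-computation 4 24 tt
period-6 : Period 6 24
period-6 = period-by-computation 6 24 tt
period-7 : Period 7 64
period-7 = period-by-computation 7 64 tt
period-14 : Period 14 144
period-14 = period-by-computation 14 144 tt
period-5 : Period 5 20
period-5 = period-by-computation 5 20 tt

period-multiple : ∀ {M N} → Period M N → ∀ t → Period M (t ℕ.* N)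
period-multiple per zero    a b n = ≡⇒≡mod (cong (w a b) (ℕ.+-identityʳ n))
period-multiple {M} {N} per (suc t) a b n = begin
  w a b (n ℕ.+ (N ℕ.+ t ℕ.* N))  ≡⟨ cong (w a b) (reindex n N (t ℕ.* N)) ⟩
  w a b ((n ℕ.+ t ℕ.* N) ℕ.+ N)  ≈⟨ per a b (n ℕ.+ t ℕ.* N) ⟩
  w a b (n ℕ.+ t ℕ.* N)          ≈⟨ period-multiple per t a b n ⟩
  w a b n                        ∎
  where
  open ModReasoning M
  reindex : ∀ n N T → n ℕ.+ (N ℕ.+ T) ≡ (n ℕ.+ T) ℕ.+ N
  reindex = ℕ-Solver.solve-∀

shift-difference : ∀ a b N k →
  w a b (k ℕ.+ N) - w a b k ≡ w (w a b N - a) (w a b (suc N) - b) k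
shift-difference a b N k =
  trans (cong (_- w a b k) (w-shift a b k N)) (w-difference _ _ a b k)

-- Write
-- w(k + N) = w(k) + M·E(k); the differences E form a Fibonacci sequence with
-- period N mod M, hence mod p, so w(n + tN) ≡ w(n) + t·M·E(n) (mod pM), and
-- the error term vanishes for t = p.
period-lift : ∀ {M N} p → p ℕDiv.∣ M → Period M N → Period (p ℕ.* M) (p ℕ.* N)
period-lift {M} {N} p p∣M per a b n
  with mod⇒∣ (per a b 0) | mod⇒∣ (per a b 1)
... | divides e₀ eq₀ | divides e₁ eq₁ =
  ≡mod-trans (accumulate p) (≡mod-via _ (drop (w a b n) (+ p * (+ M * E n)))
                                        (divides (E n) error-term))
  where
  E : ℕ → ℤ
  E = w e₀ e₁

  difference : ∀ k → w a b (k ℕ.+ N) ≡ w a b k + + M * E k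
  difference k = begin
    w a b (k ℕ.+ N)                           ≡⟨ restore (w a b (k ℕ.+ N)) (w a b k) ⟩
    w a b k + (w a b (k ℕ.+ N) - w a b k)     ≡⟨ cong (λ x → w a b k + x) (shift-difference a b N k) ⟩
    w a b k + w (w a b N - a) (w a b (suc N) - b) k
                                              ≡⟨ cong (λ x → w a b k + x) (cong₂ (λ x y → w x y k) eq₀ eq₁) ⟩
    w a b k + w (e₀ * + M) (e₁ * + M) k       ≡⟨ cong (λ x → w a b k + x) (w-scale e₀ e₁ (+ M) k) ⟩
    w a b k + E k * + M                       ≡⟨ cong (λ x → w a b k + x) (ℤ.*-comm (E k) (+ M)) ⟩
    w a b k + + M * E k                       ∎
    where
    open ≡-Reasoning
    restore : ∀ x y → x ≡ y + (x - y)
    restore = solve-∀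

  accumulate : ∀ t → w a b (n ℕ.+ t ℕ.* N) ≡ w a b n + + t * (+ M * E n) mod p ℕ.* M
  accumulate zero = ≡⇒≡mod (trans (cong (w a b) (ℕ.+-identityʳ n)) (no-term (w a b n) (+ M * E n)))
    where
    no-term : ∀ x y → x ≡ x + 0ℤ * y
    no-term = solve-∀
  accumulate (suc t) = begin
    w a b (n ℕ.+ (N ℕ.+ t ℕ.* N))
      ≡⟨ cong (w a b) (reindex n N (t ℕ.* N)) ⟩
    w a b ((n ℕ.+ t ℕ.* N) ℕ.+ N)
      ≡⟨ difference (n ℕ.+ t ℕ.* N) ⟩
    w a b (n ℕ.+ t ℕ.* N) + + M * E (n ℕ.+ t ℕ.* N)
      ≈⟨ ≡mod-+ (accumulate t)
                (≡mod-scale M (≡mod-divisor p∣M (period-multiple per t e₀ e₁ n))) ⟩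
    (w a b n + + t * (+ M * E n)) + + M * E n
      ≡⟨ one-more (w a b n) (+ t) (+ M * E n) ⟩
    w a b n + + suc t * (+ M * E n) ∎
    where
    open ModReasoning (p ℕ.* M)
    reindex : ∀ n N T → n ℕ.+ (N ℕ.+ T) ≡ (n ℕ.+ T) ℕ.+ N
    reindex = ℕ-Solver.solve-∀
    one-more : ∀ x t y → (x + t * y) + y ≡ x + (1ℤ + t) * y
    one-more = solve-∀

  drop : ∀ x y → (x + y) - x ≡ y
  drop = solve-∀
  error-term : + p * (+ M * E n) ≡ E n * + (p ℕ.* M)
  error-term = begin
    + p * (+ M * E n)    ≡⟨ regroup (+ p) (+ M) (E n) ⟩
    E n * (+ p * + M)    ≡⟨ cong (E n *_) (ℤ.pos-* p M) ⟨
    E n * + (p ℕ.* M)    ∎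
    where
    open ≡-Reasoning
    regroup : ∀ p m e → p * (m * e) ≡ e * (p * m)
    regroup = solve-∀

HasPeriod4mod20 : ℕ → Set
HasPeriod4mod20 m = ∃[ h ] Period m (4 ℕ.+ 20 ℕ.* h)

-- Lifting by 3 and then taking 7 times the period keeps it ≡ 4 (mod 20):
-- 21(4 + 20h) = 4 + 20(4 + 21h).
period4mod20-lift3 : ∀ {M} → 3 ℕDiv.∣ M → HasPeriod4mod20 M →
                     HasPeriod4mod20 (3 ℕ.* M)
period4mod20-lift3 3∣M (h , per) =
  4 ℕ.+ 21 ℕ.* h ,
  subst (Period _) (reindex h) (period-multiple (period-lift 3 3∣M per) 7)
  where
  reindex : ∀ h → 7 ℕ.* (3 ℕ.* (4 ℕ.+ 20 ℕ.* h)) ≡ 4 ℕ.+ 20 ℕ.* (4 ℕ.+ 21 ℕ.* h)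
  reindex = ℕ-Solver.solve-∀

period4mod20-3-power : ∀ j → HasPeriod4mod20 (3 ℕ.^ suc j)
period4mod20-3-power zero    = 1 , period-3
period4mod20-3-power (suc j) =
  period4mod20-lift3 (ℕDiv.m∣m*n (3 ℕ.^ j)) (period4mod20-3-power j)

InF-cofactor : ∀ {m} (inF : InF m) → ∃[ c ] m ≡ c ℕ.* 5 ℕ.^ proj₁ inF
InF-cofactor (k , inj₁ refl) = 1 , sym (ℕ.*-identityˡ _)
InF-cofactor (k , inj₂ (inj₁ refl)) = 2 , refl
InF-cofactor (k , inj₂ (inj₂ (inj₁ refl))) = 4 , refl
InF-cofactor (k , inj₂ (inj₂ (inj₂ (inj₁ (j , _ , refl))))) = 3 ℕ.^ j , refl
InF-cofactor (k , inj₂ (inj₂ (inj₂ (inj₂ (inj₁ refl))))) = 6 , refl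
InF-cofactor (k , inj₂ (inj₂ (inj₂ (inj₂ (inj₂ (inj₁ refl)))))) = 7 , refl
InF-cofactor (k , inj₂ (inj₂ (inj₂ (inj₂ (inj₂ (inj₂ refl)))))) = 14 , refl

InF-period : ∀ {m} → InF m → gcd 5 m ≡ 1 → HasPeriod4mod20 m
InF-period inF@(suc k , _) coprime with InF-cofactor inF
... | c , refl with coprime-common-divisor {5} {c ℕ.* 5 ℕ.^ suc k} coprime ℕDiv.∣-refl
                      (ℕDiv.∣-trans (ℕDiv.m∣m*n (5 ℕ.^ k)) (ℕDiv.n∣m*n c))
...   | ()
InF-period (zero , inj₁ refl) _ = 0 , period-1
InF-period (zero , inj₂ (inj₁ refl)) _ = 1 , period-2
InF-period (zero , inj₂ (inj₂ (inj₁ refl))) _ = 1 , period-4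
InF-period (zero , inj₂ (inj₂ (inj₂ (inj₁ (suc j , _ , refl))))) _ =
  subst HasPeriod4mod20 (sym (ℕ.*-identityʳ _)) (period4mod20-3-power j)
InF-period (zero , inj₂ (inj₂ (inj₂ (inj₂ (inj₁ refl))))) _ = 1 , period-6
InF-period (zero , inj₂ (inj₂ (inj₂ (inj₂ (inj₂ (inj₁ refl)))))) _ = 3 , period-7
InF-period (zero , inj₂ (inj₂ (inj₂ (inj₂ (inj₂ (inj₂ refl)))))) _ = 7 , period-14

Q : ℤ → ℤ → ℤ
Q a b = b * b - a * b - a * a

Q-step : ∀ x y → Q y (y + x) ≡ - Q x y
Q-step = expanded
  where
  expanded : ∀ x y →
    (y + x) * (y + x) - y * (y + x) - y * y ≡ - (y * y - x * y - x * x)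
  expanded = solve-∀

Q-cong : ∀ {M a a′ b b′} → a ≡ a′ mod M → b ≡ b′ mod M → Q a b ≡ Q a′ b′ mod M
Q-cong a≡a′ b≡b′ = ≡mod-+ (≡mod-+ (≡mod-* b≡b′ b≡b′) (≡mod-neg (≡mod-* a≡a′ b≡b′)))
                          (≡mod-neg (≡mod-* a≡a′ a≡a′))

Q-along : ∀ {M} a b n → Q (w a b n) (w a b (suc n)) ≡ 0ℤ mod M → Q a b ≡ 0ℤ mod M
Q-along a b zero    Q≡0 = Q≡0
Q-along {M} a b (suc n) Q≡0 = Q-along a b n
  (subst (_≡ 0ℤ mod M) (ℤ.neg-involutive _)
    (≡mod-neg (subst (_≡ 0ℤ mod M) (Q-step (w a b n) (w a b (suc n))) Q≡0)))

residue-table : ∀ {c} → c ℕ.< 5 → ∀ {d} → d ℕ.< 5 → ∀ {y} → y ℕ.< 5 →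
  Q (+ c) (+ d) ≡ 0ℤ mod 5 ⊎ ∃[ s ] (s ℕ.< 5 × w (+ c) (+ d) (4 ℕ.* s) ≡ + y mod 5)
residue-table = from-yes
  (allUpTo? (λ c → allUpTo? (λ d → allUpTo? (λ y →
    (Q (+ c) (+ d) ≡? 0ℤ mod 5) ⊎-dec
    anyUpTo? (λ s → w (+ c) (+ d) (4 ℕ.* s) ≡? + y mod 5) 5) 5) 5) 5)

mod5-progression : ∀ c d → ¬ (Q c d ≡ 0ℤ mod 5) → ∀ y →
                   ∃[ s ] w c d (4 ℕ.* s) ≡ y mod 5
mod5-progression c d 5∤Q y =
  from-table (residue-table (n%ℕd<d c 5) (n%ℕd<d d 5) (n%ℕd<d y 5))
  where
  c′ d′ : ℤ
  c′ = + (c %ℕ 5)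
  d′ = + (d %ℕ 5)
  c≡c′ : c ≡ c′ mod 5
  c≡c′ = ≡mod-residue 5 c
  d≡d′ : d ≡ d′ mod 5
  d≡d′ = ≡mod-residue 5 d
  from-table : Q c′ d′ ≡ 0ℤ mod 5 ⊎
               ∃[ s ] (s ℕ.< 5 × w c′ d′ (4 ℕ.* s) ≡ + (y %ℕ 5) mod 5) →
               ∃[ s ] w c d (4 ℕ.* s) ≡ y mod 5
  from-table (inj₁ Q≡0) = ⊥-elim (5∤Q (≡mod-trans (Q-cong c≡c′ d≡d′) Q≡0))
  from-table (inj₂ (s , _ , hit)) = s , (begin
    w c d (4 ℕ.* s)     ≈⟨ w-cong c≡c′ d≡d′ (4 ℕ.* s) ⟩
    w c′ d′ (4 ℕ.* s)   ≈⟨ hit ⟩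
    + (y %ℕ 5)          ≈⟨ ≡mod-residue 5 y ⟨
    y                   ∎)
    where
    open ModReasoning 5

-- Along a progression n₀ + sN with N ≡ 4 (mod 20) a sequence with 5 ∤ Q
-- meets every residue class mod 5: by the period 20 modulo 5 its terms
-- agree there with the terms of index n₀ + 4s.
progression-hits-mod5 : ∀ a b → ¬ (Q a b ≡ 0ℤ mod 5) → ∀ h n₀ y →
  ∃[ s ] w a b (n₀ ℕ.+ s ℕ.* (4 ℕ.+ 20 ℕ.* h)) ≡ y mod 5
progression-hits-mod5 a b 5∤Q h n₀ y =
  along (mod5-progression (w a b n₀) (w a b (suc n₀)) 5∤Q′ y)
  where
  5∤Q′ : ¬ (Q (w a b n₀) (w a b (suc n₀)) ≡ 0ℤ mod 5)
  5∤Q′ Q≡0 = 5∤Q (Q-along a b n₀ Q≡0)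
  reindex : ∀ n₀ s h →
    n₀ ℕ.+ s ℕ.* (4 ℕ.+ 20 ℕ.* h) ≡ (4 ℕ.* s ℕ.+ n₀) ℕ.+ (h ℕ.* s) ℕ.* 20
  reindex = ℕ-Solver.solve-∀
  along : ∃[ s ] w (w a b n₀) (w a b (suc n₀)) (4 ℕ.* s) ≡ y mod 5 →
          ∃[ s ] w a b (n₀ ℕ.+ s ℕ.* (4 ℕ.+ 20 ℕ.* h)) ≡ y mod 5
  along (s , hit) = s , (begin
    w a b (n₀ ℕ.+ s ℕ.* (4 ℕ.+ 20 ℕ.* h))
      ≡⟨ cong (w a b) (reindex n₀ s h) ⟩
    w a b ((4 ℕ.* s ℕ.+ n₀) ℕ.+ (h ℕ.* s) ℕ.* 20)
      ≈⟨ period-multiple period-5 (h ℕ.* s) a b (4 ℕ.* s ℕ.+ n₀) ⟩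
    w a b (4 ℕ.* s ℕ.+ n₀)
      ≡⟨ w-shift a b (4 ℕ.* s) n₀ ⟩
    w (w a b n₀) (w a b (suc n₀)) (4 ℕ.* s)
      ≈⟨ hit ⟩
    y ∎)
    where
    open ModReasoning 5

coprime⇒5∤Q : ∀ a b m → gcd (5 ℕ.* m) ∣ Q a b ∣ ≡ 1 → ¬ (Q a b ≡ 0ℤ mod 5)
coprime⇒5∤Q a b m coprime (∣⇒mod 5∣Q) = 5≢1 (coprime-common-divisor
  {5 ℕ.* m} {∣ Q a b ∣} coprime (ℕDiv.m∣m*n m)
  (subst (λ q → 5 ℕDiv.∣ ∣ q ∣) (ℤ.+-identityʳ (Q a b)) (∣⇒∣ᵤ 5∣Q)))
  where
  5≢1 : ¬ (5 ≡ 1)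
  5≢1 ()

lemma2p4 : (a b : ℤ) (m : ℕ) → m ≥ 1 → InF m → gcd 5 m ≡ 1
    → gcd (5 ℕ.* m) ∣ b * b - a * b - a * a ∣ ≡ 1
    → ResidueComplete a b m → ResidueComplete a b (5 ℕ.* m)
lemma2p4 a b (suc m) (s≤s z≤n) inF coprime₅ coprimeQ complete x _ =
  n , ∣⇒∣ᵤ (mod⇒∣ (crt coprime₅ hit₅ hitₘ))
  where
  M : ℕ
  M = suc m
  h : ℕ
  h = proj₁ (InF-period inF coprime₅)
  period : Period M (4 ℕ.+ 20 ℕ.* h)
  period = proj₂ (InF-period inF coprime₅)
  n₀ : ℕ
  n₀ = proj₁ (complete (x ℕ.% M) (m%n<n x M))
  hit₀ : w a b n₀ ≡ + x mod M
  hit₀ = ≡mod-trans (∣⇒mod (∣ᵤ⇒∣ (proj₂ (complete (x ℕ.% M) (m%n<n x M)))))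
                    (≡mod-sym (≡mod-residue M (+ x)))
  s : ℕ
  s = proj₁ (progression-hits-mod5 a b (coprime⇒5∤Q a b M coprimeQ) h n₀ (+ x))
  n : ℕ
  n = n₀ ℕ.+ s ℕ.* (4 ℕ.+ 20 ℕ.* h)
  hit₅ : w a b n ≡ + x mod 5
  hit₅ = proj₂ (progression-hits-mod5 a b (coprime⇒5∤Q a b M coprimeQ) h n₀ (+ x))
  hitₘ : w a b n ≡ + x mod M
  hitₘ = ≡mod-trans (period-multiple period s a b n₀) hit₀
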